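{- Let $n\ge 3$ be a prime and let $G$ be the graph defined in the context below. Let $P=\{v^l_{k,j}: k,l,j\in[n]\}$ and for $k,l\in[n]$ let $P^l_k=\{v^l_{k,1},\dots,v^l_{k,n}\}$. Then the subgraph $G^2[P]$ of $G^2$ induced by $P$ is isomorphic to the complete multipartite graph $K_{n* n^2}$, with partite sets exactly the $n^2$ sets $P^l_k$, $k,l\in[n]$.
   Context: For a graph $H$, $H^2$ denotes the square of $H$: the graph on $V(H)$ in which two distinct vertices are adjacent iff their distance in $H$ is at most $2$. $K_{n*r}$ denotes the complete multipartite graph with $r$ partite sets each of size $n$. Write $[n]=\{1,\dots,n\}$. For $i\in[n-1]$ define $L_i(j,k)\in[n]$ for $j,k\in[n]$ by $L_i(j,k)\equiv j+i(k-1)\pmod n$ (the residue $0$ being represented by $n$). The graph $G$ has vertex set consisting of: vertices $v^l_{k,j}$ for $k,l,j\in[n]$; vertices $w_{i,j}$ and $u_{i,j}$ for $i\in[n-1]$, $j\in[n]$; and vertices $s_m$ for $m\in[n]$ (all distinct). For $l,m\in[n]$ let $T_{l,m}=\{v^l_{1,m},v^l_{2,m},\dots,v^l_{n,m}\}$. The edges of $G$ are exactly: - $w_{i,j}v^l_{k,L_i(j,k)}$ for all $i\in[n-1]$, $j,k,l\in[n]$; - $u_{i,j}y$ for all $i\in[n-1]$, $j\in[n]$ and all $y\in T_{l,L_i(j,l)}$ for some $l\in[n]$; - $s_m y$ for all $m\in[n]$ and all $y\in T_{l,m}$ for some $l\in[n]$. -}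

module Defs where

open import Data.Nat using (ℕ; suc; _+_; _*_; _∸_; NonZero)
open import Data.Nat.DivMod using (_mod_)
open import Data.Fin using (Fin; toℕ)
open import Data.Product using (_×_; _,_; ∃-syntax)
open import Data.Sum using (_⊎_)
open import Relation.Binary.PropositionalEquality using (_≡_; _≢_)

-- Convention: [n] = {1,…,n} is represented by Fin n, where a : Fin n stands
-- for the number toℕ a + 1.  An index i ∈ [n-1] is represented by
-- i : Fin (n ∸ 1), standing for the number toℕ i + 1.

-- L_i(j,k) ≡ j + i(k-1) (mod n), residue in [n].  In the 0-based encoding
-- (value minus one) this is (j₀ + i·k₀) mod n.
L : (n : ℕ) .{{_ : NonZero n}} → Fin (n ∸ 1) → Fin n → Fin n → Fin n
L n i j k = (toℕ j + suc (toℕ i) * toℕ k) mod n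

data V (n : ℕ) : Set where
  v : (l k j : Fin n) → V n
  w : (i : Fin (n ∸ 1)) (j : Fin n) → V n
  u : (i : Fin (n ∸ 1)) (j : Fin n) → V n
  s : (m : Fin n) → V n

-- The listed edges (oriented from the non-v endpoint to the v endpoint).
data E₀ (n : ℕ) .{{_ : NonZero n}} : V n → V n → Set where
  e-w : ∀ i j k l → E₀ n (w i j) (v l k (L n i j k))
  e-u : ∀ i j l k → E₀ n (u i j) (v l k (L n i j l))
  e-s : ∀ m l k → E₀ n (s m) (v l k m)

Adj : (n : ℕ) .{{_ : NonZero n}} → V n → V n → Set
Adj n x y = E₀ n x y ⊎ E₀ n y x

Adj² : (n : ℕ) .{{_ : NonZero n}} → V n → V n → Set
Adj² n x y = x ≢ y × (Adj n x y ⊎ ∃[ z ] (Adj n x z × Adj n z y))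

-- P = {v^l_{k,j}}, indexed by (l, k, j); v is injective, so this is P.
PVert : ℕ → Set
PVert n = Fin n × Fin n × Fin n

AdjP : (n : ℕ) .{{_ : NonZero n}} → PVert n → PVert n → Set
AdjP n (l , k , j) (l' , k' , j') = Adj² n (v l k j) (v l' k' j')

partP : {n : ℕ} → PVert n → Fin n × Fin n
partP (l , k , j) = (l , k)

KVert : ℕ → ℕ → Set
KVert n r = Fin r × Fin n

AdjK : {n r : ℕ} → KVert n r → KVert n r → Set
AdjK (p , a) (q , b) = p ≢ q

partK : {n r : ℕ} → KVert n r → Fin r
partK (p , a) = p

-- Adjacency in G² between two vertices of P means a common neighbour in G,
-- since G has no edges inside P.  The neighbourhood of every vertex outside P
-- meets each part P^l_k in at most one vertex, so each part is independent in
-- G²[P].  Conversely, v^l_{k,j} and v^{l'}_{k',j'} in different parts have the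
-- common neighbour s_j if j = j'; otherwise w_{i,c} (if k ≠ k') or u_{i,c}
-- (if k = k', l ≠ l') is a common neighbour as soon as the line c + i·x over
-- ℤ/n passes through (k , j) and (k' , j') (resp. (l , j) and (l' , j')).
-- Such a line exists because n is prime, and its slope i is non-zero because
-- j ≠ j'.
module Submission where

open import Defs
open import Data.Nat using (ℕ; _*_; _≥_; NonZero)
open import Data.Nat.Primality using (Prime)
open import Data.Product using (_×_; _,_; ∃-syntax; Σ-syntax)
open import Function.Bundles using (_↔_; Inverse; _⇔_)
open import Relation.Binary.PropositionalEquality using (_≡_)

open import Data.Nat using (zero; suc; _+_; _<_; _%_; pred; ≢-nonZero)
open import Data.Nat.Properties
  using (+-comm; +-assoc; +-identityʳ; *-comm; *-distribʳ-+; suc-pred; suc[m]≤n⇒m≤pred[n])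
open import Data.Nat.DivMod
  using (_mod_; %-distribˡ-+; %-distribˡ-*; m%n%n≡m%n; m*n%n≡0; m%n<n; m<n⇒m%n≡m)
open import Data.Nat.Coprimality using (coprime-Bézout; prime⇒coprime)
open import Data.Nat.GCD using (module Bézout)
open import Data.Nat.Solver using (module +-*-Solver)
open import Data.Fin using (Fin; toℕ; fromℕ<; combine; remQuot)
open import Data.Fin.Properties
  using (toℕ<n; toℕ-fromℕ<; toℕ-injective; combine-injective; combine-remQuot; remQuot-combine; _≟_)
open import Data.Product using (proj₁; proj₂; uncurry; ∃₂)
open import Data.Sum using (inj₁; inj₂)
open import Data.Empty using (⊥-elim)
open import Function using (_∘_)
open import Function.Bundles using (mk↔ₛ′; mk⇔)
open import Function.Properties.Equivalence using () renaming (sym to ⇔-sym; trans to ⇔-trans)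
open import Function.Related.TypeIsomorphisms using (¬-cong-⇔)
open import Level using (0ℓ)
open import Relation.Nullary using (¬_; yes; no)
open import Relation.Binary using (Setoid; IsEquivalence)
open import Relation.Binary.PropositionalEquality
  using (_≢_; refl; sym; trans; cong; cong₂; subst)

open +-*-Solver using (solve; _:+_; _:*_; _:=_; con)

module Modular (n : ℕ) .{{_ : NonZero n}} where

  -- A record rather than x % n ≡ y % n, so that x and y can be inferred
  -- from a proof of x ≈ y.
  infix 4 _≈_
  record _≈_ (x y : ℕ) : Set where
    constructor mod-≡
    field %-≡ : x % n ≡ y % n

  ≈-isEquivalence : IsEquivalence _≈_
  ≈-isEquivalence = record
    { refl  = mod-≡ refl
    ; sym   = λ (mod-≡ p) → mod-≡ (sym p)
    ; trans = λ (mod-≡ p) (mod-≡ q) → mod-≡ (trans p q)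
    }

  ≈-setoid : Setoid 0ℓ 0ℓ
  ≈-setoid = record { isEquivalence = ≈-isEquivalence }

  open IsEquivalence ≈-isEquivalence public using () renaming (refl to ≈-refl; sym to ≈-sym; trans to ≈-trans)
  open import Relation.Binary.Reasoning.Setoid ≈-setoid

  ≡⇒≈ : ∀ {x y} → x ≡ y → x ≈ y
  ≡⇒≈ = mod-≡ ∘ cong (_% n)

  %-≈ : ∀ x → x % n ≈ x
  %-≈ x = mod-≡ (m%n%n≡m%n x n)

  ≈⇒≡ : ∀ {x y} → x < n → y < n → x ≈ y → x ≡ y
  ≈⇒≡ x<n y<n (mod-≡ p) = trans (sym (m<n⇒m%n≡m x<n)) (trans p (m<n⇒m%n≡m y<n))

  +-cong : ∀ {x x' y y'} → x ≈ x' → y ≈ y' → x + y ≈ x' + y'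
  +-cong {x} {x'} {y} {y'} (mod-≡ p) (mod-≡ q) = mod-≡
    (trans (%-distribˡ-+ x y n) (trans (cong₂ (λ a b → (a + b) % n) p q) (sym (%-distribˡ-+ x' y' n))))

  *-cong : ∀ {x x' y y'} → x ≈ x' → y ≈ y' → x * y ≈ x' * y'
  *-cong {x} {x'} {y} {y'} (mod-≡ p) (mod-≡ q) = mod-≡
    (trans (%-distribˡ-* x y n) (trans (cong₂ (λ a b → (a * b) % n) p q) (sym (%-distribˡ-* x' y' n))))

  +-congˡ : ∀ x {y y'} → y ≈ y' → x + y ≈ x + y'
  +-congˡ x = +-cong (≈-refl {x})

  +-congʳ : ∀ y {x x'} → x ≈ x' → x + y ≈ x' + y
  +-congʳ y p = +-cong p (≈-refl {y})

  *-congˡ : ∀ x {y y'} → y ≈ y' → x * y ≈ x * y'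
  *-congˡ x = *-cong (≈-refl {x})

  *-congʳ : ∀ y {x x'} → x ≈ x' → x * y ≈ x' * y
  *-congʳ y p = *-cong p (≈-refl {y})

  0%n≡0 : 0 % n ≡ 0
  0%n≡0 = m*n%n≡0 0 n

  multiple≈0 : ∀ k → k * n ≈ 0
  multiple≈0 k = mod-≡ (trans (m*n%n≡0 k n) (sym 0%n≡0))

  -- An additive inverse that avoids truncated subtraction.
  neg : ℕ → ℕ
  neg x = pred n * x

  neg-inverseˡ : ∀ x → neg x + x ≈ 0
  neg-inverseˡ x = begin
    pred n * x + x    ≡⟨ +-comm (pred n * x) x ⟩
    suc (pred n) * x  ≡⟨ cong (_* x) (suc-pred n) ⟩
    n * x             ≡⟨ *-comm n x ⟩
    x * n             ≈⟨ multiple≈0 x ⟩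
    0                 ∎

  +-cancelˡ : ∀ z {x y} → z + x ≈ z + y → x ≈ y
  +-cancelˡ z {x} {y} p = begin
    x                  ≈⟨ +-congʳ x (neg-inverseˡ z) ⟨
    neg z + z + x      ≡⟨ +-assoc (neg z) z x ⟩
    neg z + (z + x)    ≈⟨ +-congˡ (neg z) p ⟩
    neg z + (z + y)    ≡⟨ +-assoc (neg z) z y ⟨
    neg z + z + y      ≈⟨ +-congʳ y (neg-inverseˡ z) ⟩
    y                  ∎

  module _ (n-prime : Prime n) where

    inverse : ∀ {e} → ¬ e ≈ 0 → ∃[ x ] x * e ≈ 1
    inverse {e} e≉0 with coprime-Bézout (prime⇒coprime n-prime (m%n<n e n))
      where instance _ = ≢-nonZero (e≉0 ∘ (λ r≡0 → mod-≡ (trans r≡0 (sym 0%n≡0))))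
    ... | Bézout.-+ x y eq = y , (begin
      y * e           ≈⟨ *-congˡ y (%-≈ e) ⟨
      y * (e % n)     ≡⟨ eq ⟨
      1 + x * n       ≈⟨ +-congˡ 1 (multiple≈0 x) ⟩
      1               ∎)
    ... | Bézout.+- x y eq = neg y , +-cancelˡ (y * e) (begin
      y * e + neg y * e   ≡⟨ *-distribʳ-+ e y (neg y) ⟨
      (y + neg y) * e     ≈⟨ *-congʳ e (≈-trans (≡⇒≈ (+-comm y (neg y))) (neg-inverseˡ y)) ⟩
      0                   ≈⟨ multiple≈0 x ⟨
      x * n               ≡⟨ eq ⟨
      1 + y * (e % n)     ≈⟨ +-congˡ 1 (*-congˡ y (%-≈ e)) ⟩
      1 + y * e           ≡⟨ +-comm 1 (y * e) ⟩
      y * e + 1           ∎)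

    -- In ℤ/n, the line c + m·x through (b , a) and (b' , a') has slope
    -- m = (a - a') / (b - b') and intercept c = a - m·b.
    line-through : ∀ {b b'} → ¬ b ≈ b' → ∀ a a' → ∃₂ λ m c → c + m * b ≈ a × c + m * b' ≈ a'
    line-through {b} {b'} b≉b' a a' = m , c , on-b , on-b'
      where
      d≉0 : ¬ neg b' + b ≈ 0
      d≉0 d≈0 = b≉b' (+-cancelˡ (neg b') (≈-trans d≈0 (≈-sym (neg-inverseˡ b'))))

      x m c : ℕ
      x = proj₁ (inverse d≉0)
      m = x * (neg a' + a)
      c = a + neg (m * b)

      rise : m * (neg b' + b) + a' ≈ a
      rise = begin
        x * (neg a' + a) * (neg b' + b) + a'
          ≡⟨ solve 5 (λ x na' a d a' → x :* (na' :+ a) :* d :+ a' := (na' :+ a) :* (x :* d) :+ a')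
                     refl x (neg a') a (neg b' + b) a' ⟩
        (neg a' + a) * (x * (neg b' + b)) + a'
          ≈⟨ +-congʳ a' (*-congˡ (neg a' + a) (proj₂ (inverse d≉0))) ⟩
        (neg a' + a) * 1 + a'
          ≡⟨ solve 3 (λ na' a a' → (na' :+ a) :* con 1 :+ a' := a :+ (na' :+ a')) refl (neg a') a a' ⟩
        a + (neg a' + a')
          ≈⟨ +-congˡ a (neg-inverseˡ a') ⟩
        a + 0
          ≡⟨ +-identityʳ a ⟩
        a ∎

      on-b : c + m * b ≈ a
      on-b = begin
        a + neg (m * b) + m * b    ≡⟨ +-assoc a (neg (m * b)) (m * b) ⟩
        a + (neg (m * b) + m * b)  ≈⟨ +-congˡ a (neg-inverseˡ (m * b)) ⟩
        a + 0                      ≡⟨ +-identityʳ a ⟩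
        a                          ∎

      on-b' : c + m * b' ≈ a'
      on-b' = begin
        a + neg (m * b) + m * b'
          ≈⟨ +-congʳ (m * b') (+-congʳ (neg (m * b)) rise) ⟨
        m * (neg b' + b) + a' + neg (m * b) + m * b'
          ≡⟨ solve 6 (λ m nb' b a' nmb b' →
                        m :* (nb' :+ b) :+ a' :+ nmb :+ m :* b' := a' :+ m :* (nb' :+ b') :+ (nmb :+ m :* b))
                     refl m (neg b') b a' (neg (m * b)) b' ⟩
        a' + m * (neg b' + b') + (neg (m * b) + m * b)
          ≈⟨ +-cong (+-congˡ a' (*-congˡ m (neg-inverseˡ b'))) (neg-inverseˡ (m * b)) ⟩
        a' + m * 0 + 0
          ≡⟨ solve 2 (λ a' m → a' :+ m :* con 0 :+ con 0 := a') refl a' m ⟩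
        a'
          ∎

module _ {n : ℕ} .{{_ : NonZero n}} where

  open Modular n
  open import Relation.Binary.Reasoning.Setoid ≈-setoid

  toℕ-mod-≈ : ∀ x → toℕ (x mod n) ≈ x
  toℕ-mod-≈ x = ≈-trans (≡⇒≈ (toℕ-fromℕ< (m%n<n x n))) (%-≈ x)

  nonzero-residue : ∀ {m} → ¬ m ≈ 0 → ∃[ i ] suc (toℕ {pred n} i) ≈ m
  nonzero-residue {m} m≉0 with m % n in m%n≡r
  ... | zero  = ⊥-elim (m≉0 (mod-≡ (trans m%n≡r (sym 0%n≡0))))
  ... | suc r = fromℕ< r<pred[n] , (begin
    suc (toℕ (fromℕ< r<pred[n]))  ≡⟨ cong suc (toℕ-fromℕ< r<pred[n]) ⟩
    suc r                         ≡⟨ m%n≡r ⟨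
    m % n                         ≈⟨ %-≈ m ⟩
    m                             ∎)
    where
    r<pred[n] : r < pred n
    r<pred[n] = suc[m]≤n⇒m≤pred[n] (subst (_< n) m%n≡r (m%n<n m n))

  ≈⇒L≡ : ∀ i c x (y : Fin n) → toℕ c + suc (toℕ i) * toℕ x ≈ toℕ y → L n i c x ≡ y
  ≈⇒L≡ i c x y p = toℕ-injective (≈⇒≡ (toℕ<n (L n i c x)) (toℕ<n y)
    (≈-trans (≡⇒≈ (toℕ-fromℕ< (m%n<n _ n))) (≈-trans (%-≈ _) p)))

  L-through : Prime n → ∀ {x x' y y' : Fin n} → x ≢ x' → y ≢ y' →
              ∃₂ λ i c → L n i c x ≡ y × L n i c x' ≡ y'
  L-through n-prime {x} {x'} {y} {y'} x≢x' y≢y' = i , c mod n , on-x , on-x'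
    where
    ≈-toℕ-injective : ∀ {a b : Fin n} → toℕ a ≈ toℕ b → a ≡ b
    ≈-toℕ-injective {a} {b} = toℕ-injective ∘ ≈⇒≡ (toℕ<n a) (toℕ<n b)

    line : ∃₂ λ m c → c + m * toℕ x ≈ toℕ y × c + m * toℕ x' ≈ toℕ y'
    line = line-through n-prime (x≢x' ∘ ≈-toℕ-injective) (toℕ y) (toℕ y')

    m c : ℕ
    m = proj₁ line
    c = proj₁ (proj₂ line)

    m≉0 : ¬ m ≈ 0
    m≉0 m≈0 = y≢y' (≈-toℕ-injective (begin
      toℕ y             ≈⟨ proj₁ (proj₂ (proj₂ line)) ⟨
      c + m * toℕ x     ≈⟨ +-congˡ c (*-congʳ (toℕ x) m≈0) ⟩
      c + 0             ≈⟨ +-congˡ c (*-congʳ (toℕ x') m≈0) ⟨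
      c + m * toℕ x'    ≈⟨ proj₂ (proj₂ (proj₂ line)) ⟩
      toℕ y'            ∎))

    i : Fin (pred n)
    i = proj₁ (nonzero-residue m≉0)

    coefficients-≈ : ∀ z → toℕ (c mod n) + suc (toℕ i) * z ≈ c + m * z
    coefficients-≈ z = +-cong (toℕ-mod-≈ c) (*-congʳ z (proj₂ (nonzero-residue m≉0)))

    on-x : L n i (c mod n) x ≡ y
    on-x  = ≈⇒L≡ i (c mod n) x y (≈-trans (coefficients-≈ (toℕ x)) (proj₁ (proj₂ (proj₂ line))))

    on-x' : L n i (c mod n) x' ≡ y'
    on-x' = ≈⇒L≡ i (c mod n) x' y' (≈-trans (coefficients-≈ (toℕ x')) (proj₂ (proj₂ (proj₂ line))))

  neighbour-in-part-unique : ∀ {z l k j j'} → E₀ n z (v l k j) → E₀ n z (v l k j') → j ≡ j'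
  neighbour-in-part-unique (e-w i c k l) (e-w .i .c .k .l) = refl
  neighbour-in-part-unique (e-u i c l k) (e-u .i .c .l .k) = refl
  neighbour-in-part-unique (e-s m l k)   (e-s .m .l .k)   = refl

  same-part-nonadjacent : ∀ {l k j j'} → ¬ Adj² n (v l k j) (v l k j')
  same-part-nonadjacent (_ , inj₁ (inj₁ ()))
  same-part-nonadjacent (_ , inj₁ (inj₂ ()))
  same-part-nonadjacent (_ , inj₂ (_ , inj₁ () , _))
  same-part-nonadjacent (_ , inj₂ (_ , inj₂ _ , inj₂ ()))
  same-part-nonadjacent {l} {k} (v≢v , inj₂ (_ , inj₂ e , inj₁ e')) =
    v≢v (cong (v l k) (neighbour-in-part-unique e e'))

  v-injective-on-parts : ∀ {l k j l' k' j' : Fin n} → (l , k) ≢ (l' , k') → v l k j ≢ v l' k' j'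
  v-injective-on-parts lk≢l'k' refl = lk≢l'k' refl

  common-neighbour : ∀ {z x y} → x ≢ y → E₀ n z x → E₀ n z y → Adj² n x y
  common-neighbour x≢y e e' = x≢y , inj₂ (_ , inj₂ e , inj₁ e')

  adjacent-via-w : ∀ {l k j l' k' j' : Fin n} → (l , k) ≢ (l' , k') →
                   (∃₂ λ i c → L n i c k ≡ j × L n i c k' ≡ j') → Adj² n (v l k j) (v l' k' j')
  adjacent-via-w {l} {k} {j} {l'} {k'} {j'} lk≢l'k' (i , c , on-k , on-k') =
    common-neighbour (v-injective-on-parts lk≢l'k')
      (subst (E₀ n (w i c) ∘ v l k) on-k (e-w i c k l))
      (subst (E₀ n (w i c) ∘ v l' k') on-k' (e-w i c k' l'))

  adjacent-via-u : ∀ {l k j l' j' : Fin n} → l ≢ l' →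
                   (∃₂ λ i c → L n i c l ≡ j × L n i c l' ≡ j') → Adj² n (v l k j) (v l' k j')
  adjacent-via-u {l} {k} {j} {l'} {j'} l≢l' (i , c , on-l , on-l') =
    common-neighbour (v-injective-on-parts (l≢l' ∘ cong proj₁))
      (subst (E₀ n (u i c) ∘ v l k) on-l (e-u i c l k))
      (subst (E₀ n (u i c) ∘ v l' k) on-l' (e-u i c l' k))

  different-parts-adjacent : Prime n → ∀ {l k j l' k' j'} → (l , k) ≢ (l' , k') →
                             Adj² n (v l k j) (v l' k' j')
  different-parts-adjacent n-prime {l} {k} {j} {l'} {k'} {j'} lk≢l'k' with j ≟ j' | k ≟ k'
  ... | yes refl | _        = common-neighbour (v-injective-on-parts lk≢l'k') (e-s j l k) (e-s j l' k')
  ... | no j≢j'  | no k≢k'  = adjacent-via-w lk≢l'k' (L-through n-prime k≢k' j≢j')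
  ... | no j≢j'  | yes refl = adjacent-via-u (lk≢l'k' ∘ cong (_, k)) (L-through n-prime (lk≢l'k' ∘ cong (_, k)) j≢j')

  AdjP⇔different-parts : Prime n → ∀ x y → AdjP n x y ⇔ (partP x ≢ partP y)
  AdjP⇔different-parts n-prime (l , k , j) (l' , k' , j') = mk⇔
    (λ { adj refl → same-part-nonadjacent adj })
    (different-parts-adjacent n-prime)

PVert↔KVert : ∀ {n} → PVert n ↔ KVert n (n * n)
PVert↔KVert {n} = mk↔ₛ′ to from to∘from from∘to
  where
  to : PVert n → KVert n (n * n)
  to (l , k , j) = combine l k , j

  from : KVert n (n * n) → PVert n
  from (p , j) = proj₁ (remQuot {n} n p) , proj₂ (remQuot {n} n p) , j

  to∘from : ∀ y → to (from y) ≡ y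
  to∘from (p , j) = cong (_, j) (combine-remQuot {n} n p)

  from∘to : ∀ x → from (to x) ≡ x
  from∘to (l , k , j) = cong (λ (l , k) → l , k , j) (remQuot-combine l k)

PVert↔KVert-parts : ∀ {n} (x y : PVert n) →
  (partK {n} {n * n} (Inverse.to PVert↔KVert x) ≡ partK {n} {n * n} (Inverse.to PVert↔KVert y)) ⇔ (partP x ≡ partP y)
PVert↔KVert-parts (l , k , j) (l' , k' , j') = mk⇔
  (λ same → let l≡l' , k≡k' = combine-injective l k l' k' same in cong₂ _,_ l≡l' k≡k')
  (cong (uncurry combine))

theorem2p6 : (n : ℕ) .{{_ : NonZero n}} → n ≥ 3 → Prime n →
    Σ[ f ∈ (PVert n ↔ KVert n (n * n)) ] (((x y : PVert n) → AdjP n x y ⇔ AdjK {n} {n * n} (Inverse.to f x) (Inverse.to f y))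
    × ((x y : PVert n) → (partK {n} {n * n} (Inverse.to f x) ≡ partK {n} {n * n} (Inverse.to f y)) ⇔ (partP x ≡ partP y)))
theorem2p6 n _ n-prime = PVert↔KVert , adjacency , PVert↔KVert-parts
  where
  adjacency : (x y : PVert n) → AdjP n x y ⇔ AdjK {n} {n * n} (Inverse.to PVert↔KVert x) (Inverse.to PVert↔KVert y)
  adjacency x y = ⇔-trans (AdjP⇔different-parts n-prime x y) (¬-cong-⇔ (⇔-sym (PVert↔KVert-parts x y)))
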